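{- Let $n$ be a positive integer and let $j\in\{1,\dots,2^n-1\}$. Then, as rational functions in $z$, \[ w_{n,j+1}(z)=\frac{1}{2\,[w_{n,j}(z)]+1-w_{n,j}(z)}, \] where $[\,\cdot\,]$ denotes the integer part defined in the context.
   Context: Let $z$ be a variable. A positive linear fractional transformation is an expression $w=\frac{az+b}{cz+d}$ with $a,b,c,d\in\mathbb{N}_0=\{0,1,2,\dots\}$ and $ad-bc\neq0$. Define $\frac{w}{w+1}:=\frac{az+b}{(a+c)z+(b+d)}$ and $w+1:=\frac{(a+c)z+(b+d)}{cz+d}$. The rows are defined recursively. Row $0$ is $(z)$. For $n\ge1$, row $n$ is $(w_{n,1}(z),\dots,w_{n,2^n}(z))$, with $w_{n,2i-1}=\frac{w_{n-1,i}}{w_{n-1,i}+1}$ and $w_{n,2i}=w_{n-1,i}+1$ for $i=1,\dots,2^{n-1}$. For positive linear functions, write $cz+d\preceq az+b$ if $c\le a$ and $d\le b$. Suppose $w=\frac{az+b}{cz+d}$ satisfies $az+b\preceq cz+d$ or $cz+d\preceq az+b$. Its integer part $[w]$ is the largest $q\in\mathbb{N}_0$ such that $qc\le a$ and $qd\le b$. In particular, $[w]=0$ if $az+b\preceq cz+d$ with $az+b\neq cz+d$. For $n\ge1$, every $w_{n,j}$ satisfies this comparability condition. -}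

module Defs where

open import Data.Nat using (ℕ; zero; suc; _+_; _*_; _∸_; _≤_; _/_; _%_)
open import Data.Integer as ℤ using (ℤ; +_)
open import Data.Product using (_×_; _,_)
open import Relation.Binary.PropositionalEquality using (_≡_)

-- A positive linear fractional transformation (a z + b) / (c z + d),
-- with a b c d ∈ ℕ₀ (the condition ad - bc ≠ 0 holds for all rows' entries).
record LFT : Set where
  constructor lft
  field
    a b c d : ℕ
open LFT public

idZ : LFT
idZ = lft 1 0 0 1

-- w / (w + 1) := (a z + b) / ((a + c) z + (b + d))
frac : LFT → LFT
frac (lft a b c d) = lft a b (a + c) (b + d)

-- w + 1 := ((a + c) z + (b + d)) / (c z + d)
plus1 : LFT → LFT
plus1 (lft a b c d) = lft (a + c) (b + d) c d

-- entry0 n k = w_{n,k+1}  (0-based index k, 0 ≤ k < 2^n).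
-- w_{n,2i-1} = frac (w_{n-1,i}) and w_{n,2i} = plus1 (w_{n-1,i}),
-- i.e. 0-based: entry0 (n+1) k is frac / plus1 of entry0 n (k / 2)
-- according to whether k is even / odd.
entry0 : ℕ → ℕ → LFT
entry0 zero    k = idZ
entry0 (suc n) k with k % 2
... | zero  = frac  (entry0 n (k / 2))
... | suc _ = plus1 (entry0 n (k / 2))

W : ℕ → ℕ → LFT
W n j = entry0 n (j ∸ 1)

IsIntPart : LFT → ℕ → Set
IsIntPart (lft a b c d) q =
  (q * c ≤ a) × (q * d ≤ b) ×
  (∀ q' → q' * c ≤ a → q' * d ≤ b → q' ≤ q)

-- Linear polynomials p z + r over ℤ, as pairs (p , r);
-- quadratic polynomials as triples of coefficients (z², z, 1).
Lin : Set
Lin = ℤ × ℤ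

Quad : Set
Quad = ℤ × ℤ × ℤ

mulLin : Lin → Lin → Quad
mulLin (p , r) (p' , r') = (p ℤ.* p') , ((p ℤ.* r' ℤ.+ r ℤ.* p') , (r ℤ.* r'))

-- Equality of rational functions N₁/D₁ = N₂/D₂ (as elements of ℚ(z)),
-- by cross-multiplication of polynomials (denominators are nonzero
-- polynomials in our uses).
RatEq : Lin → Lin → Lin → Lin → Set
RatEq N₁ D₁ N₂ D₂ = mulLin N₁ D₂ ≡ mulLin N₂ D₁

numer denom : LFT → Lin
numer (lft a b c d) = (+ a) , (+ b)
denom (lft a b c d) = (+ c) , (+ d)

-- For w = (a z + b)/(c z + d) and integer q,
-- 1 / (2 q + 1 - w) = (c z + d) / ((2q+1)(c z + d) - (a z + b)).
recipNumer : LFT → ℕ → Lin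
recipNumer w q = denom w

recipDenom : LFT → ℕ → Lin
recipDenom (lft a b c d) q =
  ((+ (2 * q + 1)) ℤ.* (+ c) ℤ.- (+ a)) , ((+ (2 * q + 1)) ℤ.* (+ d) ℤ.- (+ b))

module Submission where

-- Written coefficientwise,
-- with q = [w], this is the relation  Successor w q w' :
--     a' = c,  b' = d,  c' + a = (2q+1) c,  d' + b = (2q+1) d,
-- i.e. w' = (c z + d)/((2q+1)(c z + d) - (a z + b)) without any cancellation.
-- The proof is an induction on the row n following the recursive structure:
--   * an even 0-based index 2i is the pair (w/(w+1), w+1) with w = w_{n-1,i};
--     here [w/(w+1)] = 0 (as d ≥ 1 in every row) and the relation holds for
--     every w;
--   * an odd 0-based index 2i+1 is the pair (u+1, u'/(u'+1)) with u, u'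
--     adjacent in row n-1; adding 1 raises the integer part by one and
--     Successor u q u' implies Successor (u+1) (q+1) (u'/(u'+1)).

open import Defs
open import Data.Nat using (ℕ; _+_; _≤_; _<_; _^_)
open import Data.Product using (Σ; _×_)

open import Data.Nat using (zero; suc; _*_; _%_; z≤n; s≤s)
open import Data.Nat.Properties
open import Data.Nat.DivMod using (m*n/n≡m; m*n%n≡0; [m+kn]%n≡m%n; +-distrib-/-∣ʳ)
open import Data.Nat.Divisibility using (divides-refl)
open import Data.Nat.Tactic.RingSolver using (solve-∀)
open import Data.Integer as ℤ using (+_)
import Data.Integer.Properties as ℤP
open import Data.Product using (_,_)
open import Relation.Binary.PropositionalEquality
open import Data.Empty using (⊥-elim)

data EvenOdd : ℕ → Set where
  even : ∀ i → EvenOdd (i * 2)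
  odd  : ∀ i → EvenOdd (1 + i * 2)

evenOdd : ∀ k → EvenOdd k
evenOdd zero = even 0
evenOdd (suc k) with evenOdd k
... | even i = odd i
... | odd i  = even (suc i)

entry0-even : ∀ n i → entry0 (suc n) (i * 2) ≡ frac (entry0 n i)
entry0-even n i with (i * 2) % 2 | m*n%n≡0 i 2
... | zero  | _ rewrite m*n/n≡m i 2 ⦃ _ ⦄ = refl

entry0-odd : ∀ n i → entry0 (suc n) (1 + i * 2) ≡ plus1 (entry0 n i)
entry0-odd n i with (1 + i * 2) % 2 | [m+kn]%n≡m%n 1 i 2
... | suc _ | _ rewrite +-distrib-/-∣ʳ 1 {d = 2} (divides-refl i) | m*n/n≡m i 2 ⦃ _ ⦄ = refl

-- Every entry has constant denominator coefficient d ≥ 1 (needed for [w/(w+1)] = 0).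
entry0-d-pos : ∀ n k → 1 ≤ d (entry0 n k)
entry0-d-pos zero    k = s≤s z≤n
entry0-d-pos (suc n) k with evenOdd k
... | even i rewrite entry0-even n i = ≤-trans (entry0-d-pos n i) (m≤n+m _ _)
... | odd i  rewrite entry0-odd n i  = entry0-d-pos n i

-- [w/(w+1)] = 0: the numerator b is strictly below the denominator b + d.
intPart-frac : ∀ u → 1 ≤ d u → IsIntPart (frac u) 0
intPart-frac (lft a b c d) d-pos = z≤n , z≤n , maximal
  where
  maximal : ∀ q' → q' * (a + c) ≤ a → q' * (b + d) ≤ b → q' ≤ 0
  maximal zero    _ _  = z≤n
  maximal (suc q') _ le = ⊥-elim (<-irrefl (+-identityʳ b)
    (≤-trans (+-monoʳ-< b d-pos) (≤-trans (m≤m+n (b + d) (q' * (b + d))) le)))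

-- [w + 1] = [w] + 1: since (q+1)x ≤ y + x iff q x ≤ y.
intPart-plus1 : ∀ u q → IsIntPart u q → IsIntPart (plus1 u) (suc q)
intPart-plus1 (lft a b c d) q (qc≤a , qd≤b , maximal) =
  shiftUp q qc≤a , shiftUp q qd≤b , maximal′
  where
  shiftUp : ∀ q {x y} → q * x ≤ y → suc q * x ≤ y + x
  shiftUp q {x} {y} le = subst (x + q * x ≤_) (+-comm x y) (+-monoʳ-≤ x le)

  shiftDown : ∀ q {x y} → suc q * x ≤ y + x → q * x ≤ y
  shiftDown q {x} {y} le = +-cancelˡ-≤ x _ _ (subst (x + q * x ≤_) (+-comm y x) le)

  maximal′ : ∀ q' → q' * c ≤ a + c → q' * d ≤ b + d → q' ≤ suc q
  maximal′ zero     _  _  = z≤n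
  maximal′ (suc q') le₁ le₂ = s≤s (maximal q' (shiftDown q' le₁) (shiftDown q' le₂))

record Successor (w : LFT) (q : ℕ) (w' : LFT) : Set where
  field
    a-next : a w' ≡ c w
    b-next : b w' ≡ d w
    c-next : c w' + a w ≡ (2 * q + 1) * c w
    d-next : d w' + b w ≡ (2 * q + 1) * d w

successor-even : ∀ u → Successor (frac u) 0 (plus1 u)
successor-even (lft a b c d) = record
  { a-next = refl
  ; b-next = refl
  ; c-next = trans (+-comm c a) (sym (+-identityʳ (a + c)))
  ; d-next = trans (+-comm d b) (sym (+-identityʳ (b + d)))
  }

successor-odd : ∀ u q u' → Successor u q u' → Successor (plus1 u) (suc q) (frac u')
successor-odd (lft a b c d) q (lft .(c) .(d) c' d')
  record { a-next = refl ; b-next = refl ; c-next = c-next ; d-next = d-next } =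
  record { a-next = refl ; b-next = refl ; c-next = raise c-next ; d-next = raise d-next }
  where
  -- one more copy of x on each side turns 2q+1 into 2(q+1)+1
  raise : ∀ {x x' y} → x' + y ≡ (2 * q + 1) * x → x + x' + (y + x) ≡ (2 * suc q + 1) * x
  raise {x} {x'} {y} e = begin
    x + x' + (y + x)         ≡⟨ regroup x x' y ⟩
    x + x + (x' + y)         ≡⟨ cong (λ t → x + x + t) e ⟩
    x + x + (2 * q + 1) * x  ≡⟨ absorb q x ⟩
    (2 * suc q + 1) * x      ∎
    where
    open ≡-Reasoning
    regroup : ∀ x x' y → x + x' + (y + x) ≡ x + x + (x' + y)
    regroup = solve-∀
    absorb : ∀ q x → x + x + (2 * q + 1) * x ≡ (2 * suc q + 1) * x
    absorb = solve-∀

-- The odd index 2i+1 of row n+1 has a right neighbour iff i does in row n.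
halve-bound : ∀ n i → 2 + i * 2 < 2 ^ suc n → suc i < 2 ^ n
halve-bound n i lt = *-cancelʳ-< 2 (suc i) (2 ^ n) (subst (2 + i * 2 <_) (*-comm 2 (2 ^ n)) lt)

adjacent : ∀ n k → suc k < 2 ^ n →
  Σ ℕ (λ q → IsIntPart (entry0 n k) q × Successor (entry0 n k) q (entry0 n (suc k)))
adjacent zero    k (s≤s ())
adjacent (suc n) k lt with evenOdd k
... | even i rewrite entry0-even n i | entry0-odd n i =
  0 , intPart-frac (entry0 n i) (entry0-d-pos n i) , successor-even (entry0 n i)
... | odd i with adjacent n i (halve-bound n i lt)
...   | q , isInt , succ rewrite entry0-odd n i | entry0-even n (suc i) =
  suc q , intPart-plus1 (entry0 n i) q isInt , successor-odd (entry0 n i) q (entry0 n (suc i)) succ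

pos-minus : ∀ {x y z} → x + y ≡ z → + z ℤ.- + y ≡ + x
pos-minus {x} {y} refl = begin
  + (x + y) ℤ.- + y   ≡⟨ ℤP.[+m]-[+n]≡m⊖n (x + y) y ⟩
  (x + y) ℕ⊖ y        ≡⟨ cong₂ _ℕ⊖_ (+-comm x y) (sym (+-identityʳ y)) ⟩
  (y + x) ℕ⊖ (y + 0)  ≡⟨ ℤP.+-cancelˡ-⊖ y x 0 ⟩
  x ℕ⊖ 0              ≡⟨ ℤP.⊖-≥ z≤n ⟩
  + x                 ∎
  where
  open ≡-Reasoning
  open ℤ using () renaming (_⊖_ to _ℕ⊖_)

recipDenom-successor : ∀ w q w' → Successor w q w' → recipDenom w q ≡ denom w'
recipDenom-successor (lft a b c d) q (lft _ _ c' d') s =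
  cong₂ _,_ (difference c a c' (Successor.c-next s)) (difference d b d' (Successor.d-next s))
  where
  difference : ∀ x y x' → x' + y ≡ (2 * q + 1) * x → + (2 * q + 1) ℤ.* + x ℤ.- + y ≡ + x'
  difference x y x' e = trans (cong (ℤ._- + y) (sym (ℤP.pos-* (2 * q + 1) x))) (pos-minus e)

-- The relation gives the identity of rational functions w' = 1/(2q+1-w):
-- both sides of the cross-multiplication are literally the same product.
successor⇒RatEq : ∀ w q w' → Successor w q w' →
  RatEq (numer w') (denom w') (recipNumer w q) (recipDenom w q)
successor⇒RatEq w q w' s = cong₂ mulLin numer-next (recipDenom-successor w q w' s)
  where
  numer-next : numer w' ≡ denom w
  numer-next = cong₂ _,_ (cong +_ (Successor.a-next s)) (cong +_ (Successor.b-next s))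

mainTheorem8 : (n j : ℕ) → 1 ≤ n → 1 ≤ j → j < 2 ^ n →
    Σ ℕ (λ q → IsIntPart (W n j) q ×
    RatEq (numer (W n (j + 1))) (denom (W n (j + 1)))
    (recipNumer (W n j) q) (recipDenom (W n j) q))
mainTheorem8 n (suc k) _ _ lt rewrite +-comm k 1 with adjacent n k lt
... | q , isInt , succ = q , isInt , successor⇒RatEq (entry0 n k) q (entry0 n (suc k)) succ
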